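{- Let $p:\mathrm{GF}(2)^n\to\mathrm{GF}(2)$ be a Boolean function of degree at most $2$ (a quadratic Boolean function, associated with the graph whose edges are the pairs $ab$ with $x_ax_b$ a term of $p$). Let $U\in\{I,H\}^n$ with $U\neq I^{\otimes n}$ be such that $U(-1)^p$ is flat. Then this flat spectrum can be obtained via a sequence of pivot operations: there is a finite sequence of pivots, starting from $p$, producing a Boolean function $p'$ with $U(-1)^p=(-1)^{p'}$.
   Context: $(-1)^q\in\mathbb C^{2^n}$ has entries $(-1)^{q(x)}$. A vector is flat if all its entries have absolute value $1$. $H=\frac1{\sqrt2}\begin{pmatrix}1&1\\1&-1\end{pmatrix}$, $I$ the $2\times2$ identity, and $\{I,H\}^n$ the set of $n$-fold tensor products of matrices from $\{I,H\}$. Pivot: if $q$ is a Boolean function and $i\neq j$ are such that $x_ix_j$ is a term of the algebraic normal form of $q$ and no other term of $q$ is divisible by $x_ix_j$, write $q=x_ix_j+x_i\mathcal N_i+x_j\mathcal N_j+R$ with $\mathcal N_i,\mathcal N_j,R$ not depending on $x_i,x_j$; the pivot of $q$ on $ij$ is $q_{iji}=x_ix_j+x_i\mathcal N_j+x_j\mathcal N_i+\mathcal N_i\mathcal N_j+R$. -}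

module Defs where

open import Data.Bool using (Bool; true; false; _∧_; _∨_; _xor_; if_then_else_; not)
import Data.Bool.Properties as BoolP
open import Data.Nat using (ℕ; zero; suc; _≤_)
open import Data.Fin using (Fin)
import Data.Fin.Properties as FinP
open import Data.Vec using (Vec; []; _∷_; lookup; tabulate; zipWith; replicate; count; updateAt)
import Data.Vec.Properties as VecP
open import Data.List using (List; []; _∷_; map; concatMap; foldr)
open import Data.Product using (_×_; _,_; Σ; ∃)
open import Data.Rational using (ℚ; 0ℚ; 1ℚ; ½) renaming (_+_ to _+ℚ_; _*_ to _*ℚ_; -_ to -ℚ_)
open import Relation.Nullary.Decidable using (⌊_⌋)
open import Relation.Binary.PropositionalEquality using (_≡_; _≢_)
open import Relation.Binary.Construct.Closure.ReflexiveTransitive using (Star)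

-- The field ℚ(√2) ⊂ ℝ ⊂ ℂ : a + b√2 represented as the pair (a , b).
-- All entries of U(-1)^p lie in this field.

Q2 : Set
Q2 = ℚ × ℚ

_⊕_ : Q2 → Q2 → Q2
(a , b) ⊕ (c , d) = (a +ℚ c , b +ℚ d)

_⊗_ : Q2 → Q2 → Q2
(a , b) ⊗ (c , d) = ((a *ℚ c) +ℚ ((1ℚ +ℚ 1ℚ) *ℚ (b *ℚ d)) , (a *ℚ d) +ℚ (b *ℚ c))

zeroQ2 oneQ2 minusOneQ2 invSqrt2 : Q2
zeroQ2 = (0ℚ , 0ℚ)
oneQ2 = (1ℚ , 0ℚ)
minusOneQ2 = (-ℚ 1ℚ , 0ℚ)
invSqrt2 = (0ℚ , ½)          -- 1/√2 = √2/2

-- Vectors in C^{2^n}, indexed by x ∈ GF(2)^n (false = 0, true = 1).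

CVec : ℕ → Set
CVec n = Vec Bool n → Q2

data Gate : Set where
  I H : Gate

entry : Gate → Bool → Bool → Q2        -- entry g row col
entry I false false = oneQ2
entry I false true  = zeroQ2
entry I true  false = zeroQ2
entry I true  true  = oneQ2
entry H true  true  = (0ℚ , -ℚ ½)   -- -1/√2
entry H _     _     = invSqrt2

-- Action of U = g₁ ⊗ g₂ ⊗ ... ⊗ gₙ (Kronecker product) on a vector.
applyU : ∀ {n} → Vec Gate n → CVec n → CVec n
applyU []       v []       = v []
applyU (g ∷ gs) v (y ∷ ys) =
  (entry g y false ⊗ applyU gs (λ xs → v (false ∷ xs)) ys) ⊕
  (entry g y true  ⊗ applyU gs (λ xs → v (true  ∷ xs)) ys)

-- Flat: every entry has absolute value 1. Entries are real (in ℚ(√2)),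
-- so |e| = 1 is e·e = 1.
Flat : ∀ {n} → CVec n → Set
Flat v = ∀ x → v x ⊗ v x ≡ oneQ2

-- Boolean functions in algebraic normal form.
-- A monomial is given by the indicator vector of its variable set;
-- an ANF assigns a coefficient in GF(2) to every monomial.

Mono : ℕ → Set
Mono n = Vec Bool n

ANF : ℕ → Set
ANF n = Mono n → Bool

allVecs : ∀ n → List (Vec Bool n)
allVecs zero    = [] ∷ []
allVecs (suc n) = concatMap (λ v → (false ∷ v) ∷ (true ∷ v) ∷ []) (allVecs n)

xorSum : List Bool → Bool
xorSum = foldr _xor_ false

_⊆ᵇ_ : ∀ {n} → Vec Bool n → Vec Bool n → Bool
[]       ⊆ᵇ []       = true
(a ∷ as) ⊆ᵇ (b ∷ bs) = ((not a) ∨ b) ∧ (as ⊆ᵇ bs)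

_≟ᵥ_ : ∀ {n} (u v : Vec Bool n) → _
_≟ᵥ_ = VecP.≡-dec BoolP._≟_

eval : ∀ {n} → ANF n → Vec Bool n → Bool
eval {n} q x = xorSum (map (λ m → q m ∧ (m ⊆ᵇ x)) (allVecs n))

sgn : Bool → Q2
sgn false = oneQ2
sgn true  = minusOneQ2

signVec : ∀ {n} → ANF n → CVec n
signVec q x = sgn (eval q x)

weight : ∀ {n} → Vec Bool n → ℕ
weight = count (λ b → b BoolP.≟ true)

DegreeAtMost2 : ∀ {n} → ANF n → Set
DegreeAtMost2 q = ∀ m → q m ≡ true → weight m ≤ 2

-- ring operations on ANFs (Boolean ring: x² = x)
_+ᴬ_ : ∀ {n} → ANF n → ANF n → ANF n
(a +ᴬ b) m = a m xor b m

_·ᴬ_ : ∀ {n} → ANF n → ANF n → ANF n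
_·ᴬ_ {n} a b m =
  xorSum (concatMap (λ m₁ → map (λ m₂ → a m₁ ∧ b m₂ ∧ ⌊ zipWith _∨_ m₁ m₂ ≟ᵥ m ⌋)
                                (allVecs n))
                    (allVecs n))

unitMono : ∀ {n} → Fin n → Mono n
unitMono i = tabulate (λ k → ⌊ k FinP.≟ i ⌋)

pairMono : ∀ {n} → Fin n → Fin n → Mono n
pairMono i j = tabulate (λ k → ⌊ k FinP.≟ i ⌋ ∨ ⌊ k FinP.≟ j ⌋)

var : ∀ {n} → Fin n → ANF n
var i m = ⌊ m ≟ᵥ unitMono i ⌋

PivotOK : ∀ {n} → ANF n → Fin n → Fin n → Set
PivotOK q i j =
  (q (pairMono i j) ≡ true) ×
  (∀ m → q m ≡ true → (lookup m i ∧ lookup m j) ≡ true → m ≡ pairMono i j)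

-- q = x_i x_j + x_i N_i + x_j N_j + R  with N_i, N_j, R free of x_i, x_j
avoids : ∀ {n} → Mono n → Fin n → Fin n → Bool
avoids m i j = not (lookup m i ∨ lookup m j)

Nᵢ : ∀ {n} → ANF n → Fin n → Fin n → ANF n
Nᵢ q i j m = avoids m i j ∧ q (updateAt m i (λ _ → true))

Nⱼ : ∀ {n} → ANF n → Fin n → Fin n → ANF n
Nⱼ q i j m = avoids m i j ∧ q (updateAt m j (λ _ → true))

Rest : ∀ {n} → ANF n → Fin n → Fin n → ANF n
Rest q i j m = avoids m i j ∧ q m

pivot : ∀ {n} → ANF n → Fin n → Fin n → ANF n
pivot q i j =
  (var i ·ᴬ var j) +ᴬ ((var i ·ᴬ Nⱼ q i j) +ᴬ ((var j ·ᴬ Nᵢ q i j) +ᴬ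
  ((Nᵢ q i j ·ᴬ Nⱼ q i j) +ᴬ Rest q i j)))

PivotStep : ∀ {n} → ANF n → ANF n → Set
PivotStep {n} q r = Σ (Fin n) λ i → Σ (Fin n) λ j →
  (i ≢ j) × PivotOK q i j × (r ≡ pivot q i j)

PivotSeq : ∀ {n} → ANF n → ANF n → Set
PivotSeq = Star PivotStep

-- Let Hᵢ denote the Hadamard gate on coordinate i. If xᵢxⱼ is the only term of the quadratic q divisible
-- by xᵢxⱼ, write q = xᵢxⱼ + xᵢNᵢ + xⱼNⱼ + R; then HᵢHⱼ(-1)^q only involves the two variables xᵢ, xⱼ and
-- equals (-1)^(q_iji), a finite check, and q_iji is again quadratic. If instead some i with Uᵢ = H has no
-- neighbour j with Uⱼ = H, then U(-1)^q has a zero entry: in q = xᵢa + b the coefficient a only involves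
-- coordinates on which U acts by I, so at an output where yᵢ + a(y) = 1 the transform in xᵢ cancels.
-- Flatness therefore lets us pivot on an edge between two Hadamard coordinates and replace both gates by I;
-- induction on the number of Hadamard factors concludes.
module Submission where

open import Defs
open import Algebra.Bundles using (CommutativeRing; CommutativeSemigroup)
open import Data.Bool using (Bool; true; false; not; _∧_; _∨_; _xor_)
open import Data.Bool.Properties as BoolP
  using (xor-identityʳ; ∧-distribˡ-xor; ∧-distribʳ-xor; ∧-zeroʳ; ∧-identityʳ; xor-∧-commutativeRing)
open import Data.Empty using (⊥-elim)
open import Data.Fin using (Fin; zero; suc)
import Data.Fin.Properties as FinP
open import Data.List using (List; []; _∷_; map; concatMap; _++_)
open import Data.List.Properties using (map-concatMap)
open import Data.Nat using (ℕ; zero; suc; _≤_; _<_; _+_; z≤n; s≤s; s≤s⁻¹)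
open import Data.Nat.Induction using (<-wellFounded)
import Data.Nat.Properties as NP
open import Data.Product using (Σ; ∃; _×_; _,_; proj₁; proj₂)
open import Data.Rational using (0ℚ; 1ℚ)
import Data.Rational.Properties as ℚP
open import Data.Rational.Solver using (module +-*-Solver)
open import Data.Vec using (Vec; []; _∷_; lookup; replicate; zipWith; _[_]≔_)
import Data.Vec.Properties as VecP
open import Induction.WellFounded using (Acc; acc)
open import Relation.Binary.Construct.Closure.ReflexiveTransitive using (ε; _◅_)
open import Relation.Binary.PropositionalEquality
open import Relation.Nullary using (Dec; yes; no; ¬_)
open import Relation.Nullary.Decidable using (⌊_⌋; isYes≗does; _×-dec_; ¬?)

⊕-comm : ∀ x y → x ⊕ y ≡ y ⊕ x
⊕-comm (a , b) (c , d) = cong₂ _,_ (ℚP.+-comm a c) (ℚP.+-comm b d)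

⊕-assoc : ∀ x y z → (x ⊕ y) ⊕ z ≡ x ⊕ (y ⊕ z)
⊕-assoc (a , b) (c , d) (e , f) = cong₂ _,_ (ℚP.+-assoc a c e) (ℚP.+-assoc b d f)

⊕-identityˡ : ∀ x → zeroQ2 ⊕ x ≡ x
⊕-identityˡ (a , b) = cong₂ _,_ (ℚP.+-identityˡ a) (ℚP.+-identityˡ b)

⊕-identityʳ : ∀ x → x ⊕ zeroQ2 ≡ x
⊕-identityʳ (a , b) = cong₂ _,_ (ℚP.+-identityʳ a) (ℚP.+-identityʳ b)

module _ where
  open +-*-Solver

  ⊗-comm : ∀ x y → x ⊗ y ≡ y ⊗ x
  ⊗-comm (a , b) (c , d) = cong₂ _,_
    (solve 4 (λ a b c d → a :* c :+ (con 1ℚ :+ con 1ℚ) :* (b :* d) := c :* a :+ (con 1ℚ :+ con 1ℚ) :* (d :* b)) refl a b c d)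
    (solve 4 (λ a b c d → a :* d :+ b :* c := c :* b :+ d :* a) refl a b c d)

  ⊗-assoc : ∀ x y z → (x ⊗ y) ⊗ z ≡ x ⊗ (y ⊗ z)
  ⊗-assoc (a , b) (c , d) (e , f) = cong₂ _,_
    (solve 6 (λ a b c d e f →
       (a :* c :+ (con 1ℚ :+ con 1ℚ) :* (b :* d)) :* e :+ (con 1ℚ :+ con 1ℚ) :* ((a :* d :+ b :* c) :* f)
       := a :* (c :* e :+ (con 1ℚ :+ con 1ℚ) :* (d :* f)) :+ (con 1ℚ :+ con 1ℚ) :* (b :* (c :* f :+ d :* e))) refl a b c d e f)
    (solve 6 (λ a b c d e f →
       (a :* c :+ (con 1ℚ :+ con 1ℚ) :* (b :* d)) :* f :+ (a :* d :+ b :* c) :* e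
       := a :* (c :* f :+ d :* e) :+ b :* (c :* e :+ (con 1ℚ :+ con 1ℚ) :* (d :* f))) refl a b c d e f)

  ⊗-distribˡ-⊕ : ∀ x y z → x ⊗ (y ⊕ z) ≡ (x ⊗ y) ⊕ (x ⊗ z)
  ⊗-distribˡ-⊕ (a , b) (c , d) (e , f) = cong₂ _,_
    (solve 6 (λ a b c d e f →
       a :* (c :+ e) :+ (con 1ℚ :+ con 1ℚ) :* (b :* (d :+ f))
       := (a :* c :+ (con 1ℚ :+ con 1ℚ) :* (b :* d)) :+ (a :* e :+ (con 1ℚ :+ con 1ℚ) :* (b :* f))) refl a b c d e f)
    (solve 6 (λ a b c d e f →
       a :* (d :+ f) :+ b :* (c :+ e) := (a :* d :+ b :* c) :+ (a :* f :+ b :* e)) refl a b c d e f)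

  ⊗-identityˡ : ∀ x → oneQ2 ⊗ x ≡ x
  ⊗-identityˡ (a , b) = cong₂ _,_
    (solve 2 (λ a b → con 1ℚ :* a :+ (con 1ℚ :+ con 1ℚ) :* (con 0ℚ :* b) := a) refl a b)
    (solve 2 (λ a b → con 1ℚ :* b :+ con 0ℚ :* a := b) refl a b)

  ⊗-zeroˡ : ∀ x → zeroQ2 ⊗ x ≡ zeroQ2
  ⊗-zeroˡ (a , b) = cong₂ _,_
    (solve 2 (λ a b → con 0ℚ :* a :+ (con 1ℚ :+ con 1ℚ) :* (con 0ℚ :* b) := con 0ℚ) refl a b)
    (solve 2 (λ a b → con 0ℚ :* b :+ con 0ℚ :* a := con 0ℚ) refl a b)

⊗-zeroʳ : ∀ x → x ⊗ zeroQ2 ≡ zeroQ2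
⊗-zeroʳ x = trans (⊗-comm x zeroQ2) (⊗-zeroˡ x)

⊕-commutativeSemigroup : CommutativeSemigroup _ _
⊕-commutativeSemigroup = record
  { Carrier = Q2 ; _≈_ = _≡_ ; _∙_ = _⊕_
  ; isCommutativeSemigroup = record
    { isSemigroup = record
      { isMagma = record { isEquivalence = isEquivalence ; ∙-cong = cong₂ _⊕_ }
      ; assoc = ⊕-assoc }
    ; comm = ⊕-comm } }

⊗-commutativeSemigroup : CommutativeSemigroup _ _
⊗-commutativeSemigroup = record
  { Carrier = Q2 ; _≈_ = _≡_ ; _∙_ = _⊗_
  ; isCommutativeSemigroup = record
    { isSemigroup = record
      { isMagma = record { isEquivalence = isEquivalence ; ∙-cong = cong₂ _⊗_ }
      ; assoc = ⊗-assoc }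
    ; comm = ⊗-comm } }

open import Algebra.Properties.CommutativeSemigroup ⊕-commutativeSemigroup
  using () renaming (interchange to ⊕-interchange)
open import Algebra.Properties.CommutativeSemigroup ⊗-commutativeSemigroup
  using () renaming (x∙yz≈y∙xz to ⊗-leftComm)
open import Algebra.Properties.CommutativeSemigroup (CommutativeRing.+-commutativeSemigroup xor-∧-commutativeRing)
  using () renaming (interchange to xor-interchange)

⊗-distrib-combination : ∀ e e′ a b u v u′ v′ →
  (e ⊗ ((a ⊗ u) ⊕ (b ⊗ v))) ⊕ (e′ ⊗ ((a ⊗ u′) ⊕ (b ⊗ v′)))
  ≡ (a ⊗ ((e ⊗ u) ⊕ (e′ ⊗ u′))) ⊕ (b ⊗ ((e ⊗ v) ⊕ (e′ ⊗ v′)))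
⊗-distrib-combination e e′ a b u v u′ v′ = begin
  (e ⊗ ((a ⊗ u) ⊕ (b ⊗ v))) ⊕ (e′ ⊗ ((a ⊗ u′) ⊕ (b ⊗ v′)))
    ≡⟨ cong₂ _⊕_ (⊗-distribˡ-⊕ e _ _) (⊗-distribˡ-⊕ e′ _ _) ⟩
  ((e ⊗ (a ⊗ u)) ⊕ (e ⊗ (b ⊗ v))) ⊕ ((e′ ⊗ (a ⊗ u′)) ⊕ (e′ ⊗ (b ⊗ v′)))
    ≡⟨ cong₂ _⊕_ (cong₂ _⊕_ (⊗-leftComm e a u) (⊗-leftComm e b v))
                 (cong₂ _⊕_ (⊗-leftComm e′ a u′) (⊗-leftComm e′ b v′)) ⟩
  ((a ⊗ (e ⊗ u)) ⊕ (b ⊗ (e ⊗ v))) ⊕ ((a ⊗ (e′ ⊗ u′)) ⊕ (b ⊗ (e′ ⊗ v′)))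
    ≡⟨ ⊕-interchange (a ⊗ (e ⊗ u)) (b ⊗ (e ⊗ v)) (a ⊗ (e′ ⊗ u′)) (b ⊗ (e′ ⊗ v′)) ⟩
  ((a ⊗ (e ⊗ u)) ⊕ (a ⊗ (e′ ⊗ u′))) ⊕ ((b ⊗ (e ⊗ v)) ⊕ (b ⊗ (e′ ⊗ v′)))
    ≡⟨ sym (cong₂ _⊕_ (⊗-distribˡ-⊕ a _ _) (⊗-distribˡ-⊕ b _ _)) ⟩
  (a ⊗ ((e ⊗ u) ⊕ (e′ ⊗ u′))) ⊕ (b ⊗ ((e ⊗ v) ⊕ (e′ ⊗ v′))) ∎
  where open ≡-Reasoning

zeroQ2-not-unit : zeroQ2 ⊗ zeroQ2 ≢ oneQ2
zeroQ2-not-unit ()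

sumOver : {A : Set} → List A → (A → Bool) → Bool
sumOver L f = xorSum (map f L)

xorSum-++ : ∀ xs ys → xorSum (xs ++ ys) ≡ xorSum xs xor xorSum ys
xorSum-++ []       ys = refl
xorSum-++ (x ∷ xs) ys = trans (cong (x xor_) (xorSum-++ xs ys)) (sym (BoolP.xor-assoc x _ _))

xorSum-concatMap : {A : Set} (f : A → List Bool) (xs : List A) →
  xorSum (concatMap f xs) ≡ sumOver xs (λ x → xorSum (f x))
xorSum-concatMap f []       = refl
xorSum-concatMap f (x ∷ xs) = trans (xorSum-++ (f x) (concatMap f xs)) (cong (xorSum (f x) xor_) (xorSum-concatMap f xs))

sumOver-concatMap : {A B : Set} (f : A → List B) (g : B → Bool) (xs : List A) →
  sumOver (concatMap f xs) g ≡ sumOver xs (λ x → sumOver (f x) g)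
sumOver-concatMap f g xs =
  trans (cong xorSum (map-concatMap g f xs)) (xorSum-concatMap (λ x → map g (f x)) xs)

sumOver-cong : {A : Set} (L : List A) {f g : A → Bool} → (∀ x → f x ≡ g x) → sumOver L f ≡ sumOver L g
sumOver-cong []      f≗g = refl
sumOver-cong (x ∷ L) f≗g = cong₂ _xor_ (f≗g x) (sumOver-cong L f≗g)

sumOver-false : {A : Set} (L : List A) → sumOver L (λ _ → false) ≡ false
sumOver-false []      = refl
sumOver-false (x ∷ L) = sumOver-false L

sumOver-xor : {A : Set} (L : List A) (f g : A → Bool) →
  sumOver L (λ x → f x xor g x) ≡ sumOver L f xor sumOver L g
sumOver-xor []      f g = refl
sumOver-xor (x ∷ L) f g =
  trans (cong ((f x xor g x) xor_) (sumOver-xor L f g)) (xor-interchange (f x) (g x) _ _)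

sumOver-∧ˡ : {A : Set} (L : List A) (c : Bool) (f : A → Bool) → sumOver L (λ x → c ∧ f x) ≡ c ∧ sumOver L f
sumOver-∧ˡ []      c f = sym (∧-zeroʳ c)
sumOver-∧ˡ (x ∷ L) c f = trans (cong ((c ∧ f x) xor_) (sumOver-∧ˡ L c f)) (sym (∧-distribˡ-xor c (f x) _))

sumOver-∧ʳ : {A : Set} (L : List A) (c : Bool) (f : A → Bool) → sumOver L (λ x → f x ∧ c) ≡ sumOver L f ∧ c
sumOver-∧ʳ []      c f = refl
sumOver-∧ʳ (x ∷ L) c f = trans (cong ((f x ∧ c) xor_) (sumOver-∧ʳ L c f)) (sym (∧-distribʳ-xor c (f x) _))

sumOver-comm : {A B : Set} (L : List A) (M : List B) (F : A → B → Bool) →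
  sumOver L (λ x → sumOver M (F x)) ≡ sumOver M (λ y → sumOver L (λ x → F x y))
sumOver-comm []      M F = sym (sumOver-false M)
sumOver-comm (x ∷ L) M F =
  trans (cong (sumOver M (F x) xor_) (sumOver-comm L M F)) (sym (sumOver-xor M (F x) (λ y → sumOver L (λ x → F x y))))

sumOver-true⇒∃ : {A : Set} (L : List A) (f : A → Bool) → sumOver L f ≡ true → ∃ λ x → f x ≡ true
sumOver-true⇒∃ []      f ()
sumOver-true⇒∃ (x ∷ L) f sum≡true with f x in fx≡
... | true  = x , fx≡
... | false = sumOver-true⇒∃ L f sum≡true

⌊⌋-true : {A : Set} (a? : Dec A) → A → ⌊ a? ⌋ ≡ true
⌊⌋-true (yes _) _ = refl
⌊⌋-true (no ¬a) a = ⊥-elim (¬a a)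

⌊⌋-false : {A : Set} (a? : Dec A) → ¬ A → ⌊ a? ⌋ ≡ false
⌊⌋-false (yes a) ¬a = ⊥-elim (¬a a)
⌊⌋-false (no _)  _  = refl

⌊⌋-true⇒ : {A : Set} (a? : Dec A) → ⌊ a? ⌋ ≡ true → A
⌊⌋-true⇒ (yes a) _ = a

vec-ext : ∀ {A : Set} {n} {u v : Vec A n} → (∀ k → lookup u k ≡ lookup v k) → u ≡ v
vec-ext {u = u} {v} u≗v = trans (sym (VecP.tabulate∘lookup u)) (trans (VecP.tabulate-cong u≗v) (VecP.tabulate∘lookup v))

zeros : ∀ {n} → Vec Bool n
zeros {n} = replicate n false

unitMono≡zeros[]≔true : ∀ {n} (i : Fin n) → unitMono i ≡ zeros [ i ]≔ true
unitMono≡zeros[]≔true i = vec-ext λ k → trans (VecP.lookup∘tabulate _ k) (indicator k)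
  where
  indicator : ∀ k → ⌊ k FinP.≟ i ⌋ ≡ lookup (zeros [ i ]≔ true) k
  indicator k with k FinP.≟ i
  ... | yes refl = sym (VecP.lookup∘update k zeros true)
  ... | no k≢i   = sym (trans (VecP.lookup∘update′ k≢i zeros true) (VecP.lookup-replicate k false))

lookup-pairMono-i : ∀ {n} (i j : Fin n) → lookup (pairMono i j) i ≡ true
lookup-pairMono-i i j = trans (VecP.lookup∘tabulate _ i) (cong (_∨ ⌊ i FinP.≟ j ⌋) (⌊⌋-true (i FinP.≟ i) refl))

lookup-pairMono-j : ∀ {n} (i j : Fin n) → lookup (pairMono i j) j ≡ true
lookup-pairMono-j i j =
  trans (VecP.lookup∘tabulate _ j) (trans (cong (⌊ j FinP.≟ i ⌋ ∨_) (⌊⌋-true (j FinP.≟ j) refl)) (BoolP.∨-zeroʳ ⌊ j FinP.≟ i ⌋))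

lookup-pairMono-other : ∀ {n} (i j k : Fin n) → k ≢ i → k ≢ j → lookup (pairMono i j) k ≡ false
lookup-pairMono-other i j k k≢i k≢j =
  trans (VecP.lookup∘tabulate _ k) (cong₂ _∨_ (⌊⌋-false (k FinP.≟ i) k≢i) (⌊⌋-false (k FinP.≟ j) k≢j))

⊆ᵇ-zipWith-∨ : ∀ {n} (a b x : Vec Bool n) → (zipWith _∨_ a b ⊆ᵇ x) ≡ (a ⊆ᵇ x) ∧ (b ⊆ᵇ x)
⊆ᵇ-zipWith-∨ []          []          []          = refl
⊆ᵇ-zipWith-∨ (true ∷ a)  (true ∷ b)  (true ∷ x)  = ⊆ᵇ-zipWith-∨ a b x
⊆ᵇ-zipWith-∨ (true ∷ a)  (false ∷ b) (true ∷ x)  = ⊆ᵇ-zipWith-∨ a b x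
⊆ᵇ-zipWith-∨ (true ∷ a)  (b ∷ bs)    (false ∷ x) = refl
⊆ᵇ-zipWith-∨ (false ∷ a) (true ∷ b)  (true ∷ x)  = ⊆ᵇ-zipWith-∨ a b x
⊆ᵇ-zipWith-∨ (false ∷ a) (false ∷ b) (true ∷ x)  = ⊆ᵇ-zipWith-∨ a b x
⊆ᵇ-zipWith-∨ (false ∷ a) (true ∷ b)  (false ∷ x) = sym (∧-zeroʳ (a ⊆ᵇ x))
⊆ᵇ-zipWith-∨ (false ∷ a) (false ∷ b) (false ∷ x) = ⊆ᵇ-zipWith-∨ a b x

⊆ᵇ-cong : ∀ {n} (m x y : Vec Bool n) → (∀ k → lookup m k ≡ true → lookup x k ≡ lookup y k) → (m ⊆ᵇ x) ≡ (m ⊆ᵇ y)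
⊆ᵇ-cong []          []      []      x≗y = refl
⊆ᵇ-cong (true ∷ m)  (a ∷ x) (b ∷ y) x≗y = cong₂ _∧_ (x≗y zero refl) (⊆ᵇ-cong m x y (λ k → x≗y (suc k)))
⊆ᵇ-cong (false ∷ m) (a ∷ x) (b ∷ y) x≗y = ⊆ᵇ-cong m x y (λ k → x≗y (suc k))

zeros-⊆ᵇ : ∀ {n} (x : Vec Bool n) → (zeros ⊆ᵇ x) ≡ true
zeros-⊆ᵇ []      = refl
zeros-⊆ᵇ (a ∷ x) = zeros-⊆ᵇ x

unitMono-⊆ᵇ : ∀ {n} (i : Fin n) (x : Vec Bool n) → (unitMono i ⊆ᵇ x) ≡ lookup x i
unitMono-⊆ᵇ i x = trans (cong (_⊆ᵇ x) (unitMono≡zeros[]≔true i)) (go i x)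
  where
  go : ∀ {n} (i : Fin n) (x : Vec Bool n) → ((zeros [ i ]≔ true) ⊆ᵇ x) ≡ lookup x i
  go zero    (a ∷ x) = trans (cong (a ∧_) (zeros-⊆ᵇ x)) (∧-identityʳ a)
  go (suc i) (a ∷ x) = go i x

weight-[]≔true : ∀ {n} (m : Vec Bool n) (i : Fin n) → lookup m i ≡ false → weight (m [ i ]≔ true) ≡ suc (weight m)
weight-[]≔true (false ∷ m) zero    refl = refl
weight-[]≔true (true ∷ m)  (suc i) mᵢ≡ = cong suc (weight-[]≔true m i mᵢ≡)
weight-[]≔true (false ∷ m) (suc i) mᵢ≡ = weight-[]≔true m i mᵢ≡

weight-[]≔false : ∀ {n} (m : Vec Bool n) (i : Fin n) → lookup m i ≡ true → weight m ≡ suc (weight (m [ i ]≔ false))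
weight-[]≔false (true ∷ m)  zero    refl = refl
weight-[]≔false (true ∷ m)  (suc i) mᵢ≡ = cong suc (weight-[]≔false m i mᵢ≡)
weight-[]≔false (false ∷ m) (suc i) mᵢ≡ = weight-[]≔false m i mᵢ≡

weight-zeros : ∀ n → weight (zeros {n}) ≡ 0
weight-zeros zero    = refl
weight-zeros (suc n) = weight-zeros n

weight-unitMono : ∀ {n} (i : Fin n) → weight (unitMono i) ≡ 1
weight-unitMono {n} i =
  trans (cong weight (unitMono≡zeros[]≔true i))
        (trans (weight-[]≔true zeros i (VecP.lookup-replicate i false)) (cong suc (weight-zeros n)))

weight-zipWith-∨ : ∀ {n} (a b : Vec Bool n) → weight (zipWith _∨_ a b) ≤ weight a + weight b
weight-zipWith-∨ []          []          = z≤n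
weight-zipWith-∨ (true ∷ a)  (false ∷ b) = s≤s (weight-zipWith-∨ a b)
weight-zipWith-∨ (true ∷ a)  (true ∷ b)  = s≤s (NP.≤-trans (weight-zipWith-∨ a b) (NP.+-monoʳ-≤ (weight a) (NP.n≤1+n _)))
weight-zipWith-∨ (false ∷ a) (true ∷ b)  = NP.≤-trans (s≤s (weight-zipWith-∨ a b)) (NP.≤-reflexive (sym (NP.+-suc _ _)))
weight-zipWith-∨ (false ∷ a) (false ∷ b) = weight-zipWith-∨ a b

three-ones⇒2<weight : ∀ {n} (m : Vec Bool n) {i j k : Fin n} → i ≢ j → k ≢ i → k ≢ j →
  lookup m i ≡ true → lookup m j ≡ true → lookup m k ≡ true → 2 < weight m
three-ones⇒2<weight m {i} {j} {k} i≢j k≢i k≢j mᵢ mⱼ mₖ =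
  NP.≤-trans (s≤s (s≤s (s≤s z≤n))) (NP.≤-reflexive (sym (trans w₀ (cong suc (trans w₁ (cong suc w₂))))))
  where
  m₁ m₂ : Vec Bool _
  m₁ = m [ i ]≔ false
  m₂ = m₁ [ j ]≔ false
  w₀ : weight m ≡ suc (weight m₁)
  w₀ = weight-[]≔false m i mᵢ
  w₁ : weight m₁ ≡ suc (weight m₂)
  w₁ = weight-[]≔false m₁ j (trans (VecP.lookup∘update′ (λ j≡i → i≢j (sym j≡i)) m false) mⱼ)
  w₂ : weight m₂ ≡ suc (weight (m₂ [ k ]≔ false))
  w₂ = weight-[]≔false m₂ k (trans (VecP.lookup∘update′ k≢j m₁ false) (trans (VecP.lookup∘update′ k≢i m false) mₖ))

weight≤2⇒pairMono : ∀ {n} (m : Vec Bool n) {i j : Fin n} → weight m ≤ 2 → i ≢ j →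
  lookup m i ≡ true → lookup m j ≡ true → m ≡ pairMono i j
weight≤2⇒pairMono m {i} {j} w≤2 i≢j mᵢ mⱼ = vec-ext pointwise
  where
  pointwise : ∀ k → lookup m k ≡ lookup (pairMono i j) k
  pointwise k with k FinP.≟ i | k FinP.≟ j
  ... | yes refl | _        = trans mᵢ (sym (lookup-pairMono-i i j))
  ... | no _     | yes refl = trans mⱼ (sym (lookup-pairMono-j i j))
  ... | no k≢i   | no k≢j with lookup m k in mₖ
  ...   | true  = ⊥-elim (NP.<⇒≱ (three-ones⇒2<weight m i≢j k≢i k≢j mᵢ mⱼ mₖ) w≤2)
  ...   | false = sym (lookup-pairMono-other i j k k≢i k≢j)

eval-cong : ∀ {n} {q r : ANF n} → (∀ m → q m ≡ r m) → ∀ x → eval q x ≡ eval r x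
eval-cong {n} q≗r x = sumOver-cong (allVecs n) (λ m → cong (_∧ (m ⊆ᵇ x)) (q≗r m))

eval-cons : ∀ {n} (q : ANF (suc n)) b x →
  eval q (b ∷ x) ≡ eval (λ m → q (false ∷ m)) x xor (b ∧ eval (λ m → q (true ∷ m)) x)
eval-cons {n} q b x = begin
  eval q (b ∷ x)
    ≡⟨ sumOver-concatMap (λ v → (false ∷ v) ∷ (true ∷ v) ∷ []) (λ m → q m ∧ (m ⊆ᵇ (b ∷ x))) (allVecs n) ⟩
  sumOver (allVecs n) (λ v → (q₀ v ∧ (v ⊆ᵇ x)) xor ((q₁ v ∧ (b ∧ (v ⊆ᵇ x))) xor false))
    ≡⟨ sumOver-cong (allVecs n) (λ v → cong ((q₀ v ∧ (v ⊆ᵇ x)) xor_)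
         (trans (xor-identityʳ _) (∧-leftComm (q₁ v) b (v ⊆ᵇ x)))) ⟩
  sumOver (allVecs n) (λ v → (q₀ v ∧ (v ⊆ᵇ x)) xor (b ∧ (q₁ v ∧ (v ⊆ᵇ x))))
    ≡⟨ sumOver-xor (allVecs n) _ _ ⟩
  eval q₀ x xor sumOver (allVecs n) (λ v → b ∧ (q₁ v ∧ (v ⊆ᵇ x)))
    ≡⟨ cong (eval q₀ x xor_) (sumOver-∧ˡ (allVecs n) b _) ⟩
  eval q₀ x xor (b ∧ eval q₁ x) ∎
  where
  open ≡-Reasoning
  q₀ q₁ : ANF n
  q₀ m = q (false ∷ m)
  q₁ m = q (true ∷ m)
  ∧-leftComm : ∀ a b c → a ∧ (b ∧ c) ≡ b ∧ (a ∧ c)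
  ∧-leftComm false true  c = refl
  ∧-leftComm false false c = refl
  ∧-leftComm true  b     c = refl

eval-constant-false : ∀ {n} (x : Vec Bool n) → eval (λ _ → false) x ≡ false
eval-constant-false {n} x = sumOver-false (allVecs n)

eval-+ᴬ : ∀ {n} (a b : ANF n) x → eval (a +ᴬ b) x ≡ eval a x xor eval b x
eval-+ᴬ a b [] with a [] | b []
... | true  | true  = refl
... | true  | false = refl
... | false | _     = refl
eval-+ᴬ a b (c ∷ x) = begin
  eval (a +ᴬ b) (c ∷ x)
    ≡⟨ eval-cons (a +ᴬ b) c x ⟩
  eval (a₀ +ᴬ b₀) x xor (c ∧ eval (a₁ +ᴬ b₁) x)
    ≡⟨ cong₂ (λ u v → u xor (c ∧ v)) (eval-+ᴬ a₀ b₀ x) (eval-+ᴬ a₁ b₁ x) ⟩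
  (eval a₀ x xor eval b₀ x) xor (c ∧ (eval a₁ x xor eval b₁ x))
    ≡⟨ cong ((eval a₀ x xor eval b₀ x) xor_) (∧-distribˡ-xor c (eval a₁ x) (eval b₁ x)) ⟩
  (eval a₀ x xor eval b₀ x) xor ((c ∧ eval a₁ x) xor (c ∧ eval b₁ x))
    ≡⟨ xor-interchange (eval a₀ x) (eval b₀ x) (c ∧ eval a₁ x) (c ∧ eval b₁ x) ⟩
  (eval a₀ x xor (c ∧ eval a₁ x)) xor (eval b₀ x xor (c ∧ eval b₁ x))
    ≡⟨ sym (cong₂ _xor_ (eval-cons a c x) (eval-cons b c x)) ⟩
  eval a (c ∷ x) xor eval b (c ∷ x) ∎
  where
  open ≡-Reasoning
  a₀ a₁ b₀ b₁ : ANF _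
  a₀ m = a (false ∷ m)
  a₁ m = a (true ∷ m)
  b₀ m = b (false ∷ m)
  b₁ m = b (true ∷ m)

⌊≟ᵥ⌋-∷ : ∀ {n} c d (u v : Vec Bool n) → ⌊ (c ∷ u) ≟ᵥ (d ∷ v) ⌋ ≡ ⌊ c BoolP.≟ d ⌋ ∧ ⌊ u ≟ᵥ v ⌋
⌊≟ᵥ⌋-∷ c d u v =
  trans (isYes≗does ((c ∷ u) ≟ᵥ (d ∷ v))) (sym (cong₂ _∧_ (isYes≗does (c BoolP.≟ d)) (isYes≗does (u ≟ᵥ v))))

sumOver-allVecs-point : ∀ {n} (u : Vec Bool n) (P : Vec Bool n → Bool) →
  sumOver (allVecs n) (λ m → ⌊ u ≟ᵥ m ⌋ ∧ P m) ≡ P u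
sumOver-allVecs-point []      P = xor-identityʳ (P [])
sumOver-allVecs-point {suc n} (c ∷ u) P =
  trans (sumOver-concatMap (λ v → (false ∷ v) ∷ (true ∷ v) ∷ []) (λ m → ⌊ (c ∷ u) ≟ᵥ m ⌋ ∧ P m) (allVecs n))
  (trans (sumOver-cong (allVecs n) (select c))
         (sumOver-allVecs-point u (λ v → P (c ∷ v))))
  where
  select : ∀ c v →
    (⌊ (c ∷ u) ≟ᵥ (false ∷ v) ⌋ ∧ P (false ∷ v)) xor ((⌊ (c ∷ u) ≟ᵥ (true ∷ v) ⌋ ∧ P (true ∷ v)) xor false)
    ≡ ⌊ u ≟ᵥ v ⌋ ∧ P (c ∷ v)
  select false v rewrite ⌊≟ᵥ⌋-∷ false false u v | ⌊≟ᵥ⌋-∷ false true u v = xor-identityʳ _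
  select true  v rewrite ⌊≟ᵥ⌋-∷ true false u v  | ⌊≟ᵥ⌋-∷ true true u v  = xor-identityʳ _

eval-·ᴬ : ∀ {n} (a b : ANF n) x → eval (a ·ᴬ b) x ≡ eval a x ∧ eval b x
eval-·ᴬ {n} a b x = begin
  sumOver L (λ m → (a ·ᴬ b) m ∧ (m ⊆ᵇ x))
    ≡⟨ sumOver-cong L (λ m → cong (_∧ (m ⊆ᵇ x)) (xorSum-concatMap (λ m₁ → map (λ m₂ → K m₁ m₂ m) L) L)) ⟩
  sumOver L (λ m → sumOver L (λ m₁ → sumOver L (λ m₂ → K m₁ m₂ m)) ∧ (m ⊆ᵇ x))
    ≡⟨ sumOver-cong L (λ m → trans (sym (sumOver-∧ʳ L (m ⊆ᵇ x) _))
                                   (sumOver-cong L (λ m₁ → sym (sumOver-∧ʳ L (m ⊆ᵇ x) _)))) ⟩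
  sumOver L (λ m → sumOver L (λ m₁ → sumOver L (λ m₂ → K m₁ m₂ m ∧ (m ⊆ᵇ x))))
    ≡⟨ sumOver-comm L L _ ⟩
  sumOver L (λ m₁ → sumOver L (λ m → sumOver L (λ m₂ → K m₁ m₂ m ∧ (m ⊆ᵇ x))))
    ≡⟨ sumOver-cong L (λ m₁ → sumOver-comm L L _) ⟩
  sumOver L (λ m₁ → sumOver L (λ m₂ → sumOver L (λ m → K m₁ m₂ m ∧ (m ⊆ᵇ x))))
    ≡⟨ sumOver-cong L (λ m₁ → sumOver-cong L (λ m₂ →
         trans (sumOver-cong L (λ m → reorder (a m₁) (b m₂) _ (m ⊆ᵇ x)))
               (sumOver-allVecs-point (zipWith _∨_ m₁ m₂) (λ m → a m₁ ∧ b m₂ ∧ (m ⊆ᵇ x))))) ⟩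
  sumOver L (λ m₁ → sumOver L (λ m₂ → a m₁ ∧ b m₂ ∧ (zipWith _∨_ m₁ m₂ ⊆ᵇ x)))
    ≡⟨ sumOver-cong L (λ m₁ → sumOver-cong L (λ m₂ →
         trans (cong (λ s → a m₁ ∧ b m₂ ∧ s) (⊆ᵇ-zipWith-∨ m₁ m₂ x)) (regroup (a m₁) (b m₂) _ _))) ⟩
  sumOver L (λ m₁ → sumOver L (λ m₂ → (a m₁ ∧ (m₁ ⊆ᵇ x)) ∧ (b m₂ ∧ (m₂ ⊆ᵇ x))))
    ≡⟨ sumOver-cong L (λ m₁ → sumOver-∧ˡ L (a m₁ ∧ (m₁ ⊆ᵇ x)) _) ⟩
  sumOver L (λ m₁ → (a m₁ ∧ (m₁ ⊆ᵇ x)) ∧ eval b x)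
    ≡⟨ sumOver-∧ʳ L (eval b x) _ ⟩
  eval a x ∧ eval b x ∎
  where
  open ≡-Reasoning
  L : List (Vec Bool n)
  L = allVecs n
  K : Vec Bool n → Vec Bool n → Vec Bool n → Bool
  K m₁ m₂ m = a m₁ ∧ b m₂ ∧ ⌊ zipWith _∨_ m₁ m₂ ≟ᵥ m ⌋
  reorder : ∀ p q d s → (p ∧ q ∧ d) ∧ s ≡ d ∧ (p ∧ q ∧ s)
  reorder true  true  d     s = refl
  reorder true  false d     s = sym (∧-zeroʳ d)
  reorder false q     d     s = sym (∧-zeroʳ d)
  regroup : ∀ p q s t → p ∧ q ∧ (s ∧ t) ≡ (p ∧ s) ∧ (q ∧ t)
  regroup true  true  s t = refl
  regroup true  false s t = sym (∧-zeroʳ s)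
  regroup false q     s t = refl

eval-var : ∀ {n} (i : Fin n) x → eval (var i) x ≡ lookup x i
eval-var {n} i x = begin
  sumOver (allVecs n) (λ m → ⌊ m ≟ᵥ unitMono i ⌋ ∧ (m ⊆ᵇ x))
    ≡⟨ sumOver-cong (allVecs n) (λ m → cong (_∧ (m ⊆ᵇ x)) (⌊≟ᵥ⌋-sym m (unitMono i))) ⟩
  sumOver (allVecs n) (λ m → ⌊ unitMono i ≟ᵥ m ⌋ ∧ (m ⊆ᵇ x))
    ≡⟨ sumOver-allVecs-point (unitMono i) (_⊆ᵇ x) ⟩
  unitMono i ⊆ᵇ x
    ≡⟨ unitMono-⊆ᵇ i x ⟩
  lookup x i ∎
  where
  open ≡-Reasoning
  ⌊≟ᵥ⌋-sym : ∀ (u v : Vec Bool n) → ⌊ u ≟ᵥ v ⌋ ≡ ⌊ v ≟ᵥ u ⌋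
  ⌊≟ᵥ⌋-sym u v with v ≟ᵥ u
  ... | yes v≡u = ⌊⌋-true (u ≟ᵥ v) (sym v≡u)
  ... | no  v≢u = ⌊⌋-false (u ≟ᵥ v) (λ u≡v → v≢u (sym u≡v))

eval-agree : ∀ {n} (q : ANF n) (P : Fin n → Set) →
  (∀ m → q m ≡ true → ∀ k → lookup m k ≡ true → P k) →
  ∀ x y → (∀ k → P k → lookup x k ≡ lookup y k) → eval q x ≡ eval q y
eval-agree {n} q P vars⊆P x y x≗y = sumOver-cong (allVecs n) term
  where
  term : ∀ m → q m ∧ (m ⊆ᵇ x) ≡ q m ∧ (m ⊆ᵇ y)
  term m with q m in qm
  ... | false = refl
  ... | true  = ⊆ᵇ-cong m x y (λ k mₖ → x≗y k (vars⊆P m qm k mₖ))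

-- Splitting off one variable: q = xᵢ · cofactor i q + remainder i q

cofactor remainder : ∀ {n} → Fin n → ANF n → ANF n
cofactor  i q m = not (lookup m i) ∧ q (m [ i ]≔ true)
remainder i q m = not (lookup m i) ∧ q m

eval-split : ∀ {n} (i : Fin n) (q : ANF n) x →
  eval q x ≡ (lookup x i ∧ eval (cofactor i q) x) xor eval (remainder i q) x
eval-split {suc n} zero q (b ∷ x) =
  trans (eval-cons q b x)
  (trans (first-variable b (eval (λ m → q (false ∷ m)) x) (eval (λ m → q (true ∷ m)) x))
  (sym (cong₂ _xor_
    (cong (b ∧_) (trans (eval-cons (cofactor zero q) b x) (cong (λ z → eval (λ m → q (true ∷ m)) x xor (b ∧ z)) (eval-constant-false x))))
    (trans (eval-cons (remainder zero q) b x) (cong (λ z → eval (λ m → q (false ∷ m)) x xor (b ∧ z)) (eval-constant-false x))))))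
  where
  first-variable : ∀ b e₀ e₁ → e₀ xor (b ∧ e₁) ≡ (b ∧ (e₁ xor (b ∧ false))) xor (e₀ xor (b ∧ false))
  first-variable true  e₀ e₁ = trans (BoolP.xor-comm e₀ e₁) (sym (cong₂ _xor_ (xor-identityʳ e₁) (xor-identityʳ e₀)))
  first-variable false e₀ e₁ = refl
eval-split {suc n} (suc i) q (b ∷ x) =
  trans (eval-cons q b x)
  (trans (cong₂ (λ u v → u xor (b ∧ v)) (eval-split i q₀ x) (eval-split i q₁ x))
  (trans (later-variable b (lookup x i) (eval (cofactor i q₀) x) (eval (remainder i q₀) x)
                                        (eval (cofactor i q₁) x) (eval (remainder i q₁) x))
  (sym (cong₂ _xor_ (cong (lookup x i ∧_) (eval-cons (cofactor (suc i) q) b x))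
                    (eval-cons (remainder (suc i) q) b x)))))
  where
  q₀ q₁ : ANF n
  q₀ m = q (false ∷ m)
  q₁ m = q (true ∷ m)
  later-variable : ∀ b t a₀ r₀ a₁ r₁ →
    ((t ∧ a₀) xor r₀) xor (b ∧ ((t ∧ a₁) xor r₁)) ≡ (t ∧ (a₀ xor (b ∧ a₁))) xor (r₀ xor (b ∧ r₁))
  later-variable false t a₀ r₀ a₁ r₁ =
    trans (xor-identityʳ _) (sym (cong₂ _xor_ (cong (t ∧_) (xor-identityʳ a₀)) (xor-identityʳ r₀)))
  later-variable true  t a₀ r₀ a₁ r₁ =
    trans (xor-interchange (t ∧ a₀) r₀ (t ∧ a₁) r₁) (cong (_xor (r₀ xor r₁)) (sym (∧-distribˡ-xor t a₀ a₁)))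

Avoids : ∀ {n} → ANF n → Fin n → Set
Avoids r k = ∀ m → r m ≡ true → lookup m k ≡ false

not-∧-true : ∀ a {c} → not a ∧ c ≡ true → a ≡ false × c ≡ true
not-∧-true false c≡true = refl , c≡true

cofactor-avoids : ∀ {n} (i : Fin n) q → Avoids (cofactor i q) i
cofactor-avoids i q m cofactor≡true = proj₁ (not-∧-true (lookup m i) cofactor≡true)

remainder-avoids : ∀ {n} (i : Fin n) q → Avoids (remainder i q) i
remainder-avoids i q m remainder≡true = proj₁ (not-∧-true (lookup m i) remainder≡true)

eval-[]≔ : ∀ {n} (r : ANF n) {k} → Avoids r k → ∀ x b → eval r (x [ k ]≔ b) ≡ eval r x
eval-[]≔ r {k} r-avoids-k x b = eval-agree r (_≢ k) vars≢k (x [ k ]≔ b) x (λ l l≢k → VecP.lookup∘update′ l≢k x b)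
  where
  vars≢k : ∀ m → r m ≡ true → ∀ l → lookup m l ≡ true → l ≢ k
  vars≢k m rm l mₗ refl with () ← trans (sym mₗ) (r-avoids-k m rm)

Degree≤ : ∀ {n} → ℕ → ANF n → Set
Degree≤ d q = ∀ m → q m ≡ true → weight m ≤ d

Degree≤-var : ∀ {n} (i : Fin n) → Degree≤ 1 (var i)
Degree≤-var i m m≡xᵢ = NP.≤-reflexive (trans (cong weight (⌊⌋-true⇒ (m ≟ᵥ unitMono i) m≡xᵢ)) (weight-unitMono i))

Degree≤-+ᴬ : ∀ {n d} {a b : ANF n} → Degree≤ d a → Degree≤ d b → Degree≤ d (a +ᴬ b)
Degree≤-+ᴬ {a = a} {b} deg-a deg-b m a+b≡true with a m in am | b m in bm
... | true  | false = deg-a m am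
... | false | true  = deg-b m bm

·ᴬ-monomial : ∀ {n} (a b : ANF n) m → (a ·ᴬ b) m ≡ true →
  ∃ λ m₁ → ∃ λ m₂ → a m₁ ≡ true × b m₂ ≡ true × zipWith _∨_ m₁ m₂ ≡ m
·ᴬ-monomial {n} a b m ab≡true
  with m₁ , inner≡true ← sumOver-true⇒∃ (allVecs n) _
         (trans (sym (xorSum-concatMap (λ m₁ → map (λ m₂ → a m₁ ∧ b m₂ ∧ ⌊ zipWith _∨_ m₁ m₂ ≟ᵥ m ⌋) (allVecs n))
                                       (allVecs n)))
                ab≡true)
  with m₂ , term≡true ← sumOver-true⇒∃ (allVecs n) _ inner≡true
  with a m₁ in am₁ | b m₂ in bm₂
... | true | true = m₁ , m₂ , am₁ , bm₂ , ⌊⌋-true⇒ (zipWith _∨_ m₁ m₂ ≟ᵥ m) term≡true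

Degree≤-·ᴬ : ∀ {n d e} {a b : ANF n} → Degree≤ d a → Degree≤ e b → Degree≤ (d + e) (a ·ᴬ b)
Degree≤-·ᴬ {a = a} {b} deg-a deg-b m ab≡true with m₁ , m₂ , am₁ , bm₂ , refl ← ·ᴬ-monomial a b m ab≡true =
  NP.≤-trans (weight-zipWith-∨ m₁ m₂) (NP.+-mono-≤ (deg-a m₁ am₁) (deg-b m₂ bm₂))

avoids-∧-true : ∀ {n} (m : Mono n) i j {c} → avoids m i j ∧ c ≡ true →
  lookup m i ≡ false × lookup m j ≡ false × c ≡ true
avoids-∧-true m i j c≡true with lookup m i | lookup m j
... | false | false = refl , refl , c≡true

Degree≤-Nᵢ : ∀ {n d} {q : ANF n} {i j} → Degree≤ (suc d) q → Degree≤ d (Nᵢ q i j)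
Degree≤-Nᵢ {d = d} {i = i} {j} deg-q m Nᵢm≡true
  with mᵢ , _ , qm ← avoids-∧-true m i j Nᵢm≡true =
  s≤s⁻¹ (subst (_≤ suc d) (weight-[]≔true m i mᵢ) (deg-q _ qm))

Degree≤-Nⱼ : ∀ {n d} {q : ANF n} {i j} → Degree≤ (suc d) q → Degree≤ d (Nⱼ q i j)
Degree≤-Nⱼ {d = d} {i = i} {j} deg-q m Nⱼm≡true
  with _ , mⱼ , qm ← avoids-∧-true m i j Nⱼm≡true =
  s≤s⁻¹ (subst (_≤ suc d) (weight-[]≔true m j mⱼ) (deg-q _ qm))

Degree≤-Rest : ∀ {n d} {q : ANF n} {i j} → Degree≤ d q → Degree≤ d (Rest q i j)
Degree≤-Rest {i = i} {j} deg-q m Rm≡true with _ , _ , qm ← avoids-∧-true m i j Rm≡true = deg-q m qm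

Degree≤-pivot : ∀ {n} {q : ANF n} {i j} → Degree≤ 2 q → Degree≤ 2 (pivot q i j)
Degree≤-pivot {q = q} {i} {j} deg-q =
  Degree≤-+ᴬ (Degree≤-·ᴬ (Degree≤-var i) (Degree≤-var j))
  (Degree≤-+ᴬ (Degree≤-·ᴬ (Degree≤-var i) (Degree≤-Nⱼ {q = q} deg-q))
  (Degree≤-+ᴬ (Degree≤-·ᴬ (Degree≤-var j) (Degree≤-Nᵢ {q = q} deg-q))
  (Degree≤-+ᴬ (Degree≤-·ᴬ (Degree≤-Nᵢ {q = q} deg-q) (Degree≤-Nⱼ {q = q} deg-q))
              (Degree≤-Rest {q = q} deg-q))))

-- Tensor products of gates

applyU-cong : ∀ {n} (U : Vec Gate n) {v w : CVec n} → (∀ x → v x ≡ w x) → ∀ y → applyU U v y ≡ applyU U w y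
applyU-cong []      v≗w []       = v≗w []
applyU-cong (g ∷ U) v≗w (y ∷ ys) =
  cong₂ _⊕_ (cong (entry g y false ⊗_) (applyU-cong U (λ x → v≗w (false ∷ x)) ys))
            (cong (entry g y true ⊗_)  (applyU-cong U (λ x → v≗w (true ∷ x)) ys))

applyU-I∷ : ∀ {n} (U : Vec Gate n) v y ys → applyU (I ∷ U) v (y ∷ ys) ≡ applyU U (λ xs → v (y ∷ xs)) ys
applyU-I∷ U v false ys = trans (cong₂ _⊕_ (⊗-identityˡ w₀) (⊗-zeroˡ w₁)) (⊕-identityʳ w₀)
  where
  w₀ w₁ : Q2
  w₀ = applyU U (λ xs → v (false ∷ xs)) ys
  w₁ = applyU U (λ xs → v (true ∷ xs)) ys
applyU-I∷ U v true  ys = trans (cong₂ _⊕_ (⊗-zeroˡ w₀) (⊗-identityˡ w₁)) (⊕-identityˡ w₁)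
  where
  w₀ w₁ : Q2
  w₀ = applyU U (λ xs → v (false ∷ xs)) ys
  w₁ = applyU U (λ xs → v (true ∷ xs)) ys

applyU-identity : ∀ n (v : CVec n) y → applyU (replicate n I) v y ≡ v y
applyU-identity zero    v []       = refl
applyU-identity (suc n) v (y ∷ ys) =
  trans (applyU-I∷ (replicate n I) v y ys) (applyU-identity n (λ xs → v (y ∷ xs)) ys)

applyU-linear : ∀ {n} (U : Vec Gate n) a b (f g : CVec n) y →
  applyU U (λ xs → (a ⊗ f xs) ⊕ (b ⊗ g xs)) y ≡ (a ⊗ applyU U f y) ⊕ (b ⊗ applyU U g y)
applyU-linear []      a b f g [] = refl
applyU-linear (h ∷ U) a b f g (y ∷ ys) =
  trans (cong₂ _⊕_ (cong (entry h y false ⊗_) (applyU-linear U a b (λ xs → f (false ∷ xs)) (λ xs → g (false ∷ xs)) ys))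
                   (cong (entry h y true ⊗_)  (applyU-linear U a b (λ xs → f (true ∷ xs))  (λ xs → g (true ∷ xs)) ys)))
        (⊗-distrib-combination (entry h y false) (entry h y true) a b _ _ _ _)

hadamard₁ : (Bool → Q2) → Bool → Q2
hadamard₁ f y = (entry H y false ⊗ f false) ⊕ (entry H y true ⊗ f true)

H-at : ∀ {n} → Fin n → Vec Gate n
H-at {n} i = replicate n I [ i ]≔ H

applyU-H-at : ∀ {n} (i : Fin n) (v : CVec n) y →
  applyU (H-at i) v y ≡ hadamard₁ (λ s → v (y [ i ]≔ s)) (lookup y i)
applyU-H-at {suc n} zero    v (y ∷ ys) =
  cong₂ _⊕_ (cong (entry H y false ⊗_) (applyU-identity n (λ xs → v (false ∷ xs)) ys))
            (cong (entry H y true ⊗_)  (applyU-identity n (λ xs → v (true ∷ xs)) ys))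
applyU-H-at {suc n} (suc i) v (y ∷ ys) = trans (applyU-I∷ (H-at i) v y ys) (applyU-H-at i (λ xs → v (y ∷ xs)) ys)

applyU-factor : ∀ {n} (U : Vec Gate n) (i : Fin n) → lookup U i ≡ H → ∀ (v : CVec n) y →
  applyU U v y ≡ applyU (U [ i ]≔ I) (applyU (H-at i) v) y
applyU-factor {suc n} (.H ∷ U) zero refl v (y ∷ ys) = sym (begin
  applyU (I ∷ U) (applyU (H-at zero) v) (y ∷ ys)
    ≡⟨ applyU-I∷ U (applyU (H-at zero) v) y ys ⟩
  applyU U (λ xs → (entry H y false ⊗ applyU (replicate n I) v₀ xs) ⊕ (entry H y true ⊗ applyU (replicate n I) v₁ xs)) ys
    ≡⟨ applyU-cong U (λ xs → cong₂ _⊕_ (cong (entry H y false ⊗_) (applyU-identity n v₀ xs))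
                                       (cong (entry H y true ⊗_)  (applyU-identity n v₁ xs))) ys ⟩
  applyU U (λ xs → (entry H y false ⊗ v₀ xs) ⊕ (entry H y true ⊗ v₁ xs)) ys
    ≡⟨ applyU-linear U (entry H y false) (entry H y true) v₀ v₁ ys ⟩
  applyU (H ∷ U) v (y ∷ ys) ∎)
  where
  open ≡-Reasoning
  v₀ v₁ : CVec n
  v₀ xs = v (false ∷ xs)
  v₁ xs = v (true ∷ xs)
applyU-factor {suc n} (g ∷ U) (suc i) Uᵢ≡H v (y ∷ ys) =
  cong₂ _⊕_ (cong (entry g y false ⊗_) (branch false)) (cong (entry g y true ⊗_) (branch true))
  where
  branch : ∀ b → applyU U (λ xs → v (b ∷ xs)) ys ≡ applyU (U [ i ]≔ I) (λ xs → applyU (H-at (suc i)) v (b ∷ xs)) ys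
  branch b = trans (applyU-factor U i Uᵢ≡H (λ xs → v (b ∷ xs)) ys)
                   (applyU-cong (U [ i ]≔ I) (λ xs → sym (applyU-I∷ (H-at i) v b xs)) ys)

-- An entry of U w only involves w on the inputs agreeing with the output wherever U has a factor I.
applyU-vanishes : ∀ {n} (U : Vec Gate n) (w : CVec n) y →
  (∀ x → (∀ k → lookup U k ≡ I → lookup x k ≡ lookup y k) → w x ≡ zeroQ2) → applyU U w y ≡ zeroQ2
applyU-vanishes []      w []       w≡0 = w≡0 [] (λ ())
applyU-vanishes (I ∷ U) w (y ∷ ys) w≡0 =
  trans (applyU-I∷ U w y ys)
        (applyU-vanishes U (λ xs → w (y ∷ xs)) ys (λ xs agree → w≡0 (y ∷ xs) λ { zero _ → refl ; (suc k) → agree k }))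
applyU-vanishes (H ∷ U) w (y ∷ ys) w≡0 =
  trans (cong₂ _⊕_ (trans (cong (entry H y false ⊗_) (branch false)) (⊗-zeroʳ (entry H y false)))
                   (trans (cong (entry H y true ⊗_) (branch true)) (⊗-zeroʳ (entry H y true))))
        (⊕-identityʳ zeroQ2)
  where
  branch : ∀ b → applyU U (λ xs → w (b ∷ xs)) ys ≡ zeroQ2
  branch b = applyU-vanishes U (λ xs → w (b ∷ xs)) ys (λ xs agree → w≡0 (b ∷ xs) λ { zero () ; (suc k) → agree k })

hadamard-affine-vanishes : ∀ a b y → y xor a ≡ true → hadamard₁ (λ s → sgn ((s ∧ a) xor b)) y ≡ zeroQ2
hadamard-affine-vanishes false true  true  refl = refl
hadamard-affine-vanishes false false true  refl = refl
hadamard-affine-vanishes true  true  false refl = refl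
hadamard-affine-vanishes true  false false refl = refl

quad₂ : Bool → Bool → Bool → Bool → Bool → Bool
quad₂ a b r s t = (s ∧ t) xor ((s ∧ a) xor ((t ∧ b) xor r))

-- The pivot rule in the two variables s, t.
hadamard²-quad₂ : ∀ a b r s t →
  hadamard₁ (λ t′ → hadamard₁ (λ s′ → sgn (quad₂ a b r s′ t′)) s) t ≡ sgn (quad₂ b a ((a ∧ b) xor r) s t)
hadamard²-quad₂ false false false false false = refl
hadamard²-quad₂ false false false false true  = refl
hadamard²-quad₂ false false false true  false = refl
hadamard²-quad₂ false false false true  true  = refl
hadamard²-quad₂ false false true  false false = refl
hadamard²-quad₂ false false true  false true  = refl
hadamard²-quad₂ false false true  true  false = refl
hadamard²-quad₂ false false true  true  true  = refl
hadamard²-quad₂ false true  false false false = refl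
hadamard²-quad₂ false true  false false true  = refl
hadamard²-quad₂ false true  false true  false = refl
hadamard²-quad₂ false true  false true  true  = refl
hadamard²-quad₂ false true  true  false false = refl
hadamard²-quad₂ false true  true  false true  = refl
hadamard²-quad₂ false true  true  true  false = refl
hadamard²-quad₂ false true  true  true  true  = refl
hadamard²-quad₂ true  false false false false = refl
hadamard²-quad₂ true  false false false true  = refl
hadamard²-quad₂ true  false false true  false = refl
hadamard²-quad₂ true  false false true  true  = refl
hadamard²-quad₂ true  false true  false false = refl
hadamard²-quad₂ true  false true  false true  = refl
hadamard²-quad₂ true  false true  true  false = refl
hadamard²-quad₂ true  false true  true  true  = refl
hadamard²-quad₂ true  true  false false false = refl
hadamard²-quad₂ true  true  false false true  = refl
hadamard²-quad₂ true  true  false true  false = refl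
hadamard²-quad₂ true  true  false true  true  = refl
hadamard²-quad₂ true  true  true  false false = refl
hadamard²-quad₂ true  true  true  false true  = refl
hadamard²-quad₂ true  true  true  true  false = refl
hadamard²-quad₂ true  true  true  true  true  = refl

hadamard₁-cong : ∀ {f g : Bool → Q2} → (∀ s → f s ≡ g s) → ∀ y → hadamard₁ f y ≡ hadamard₁ g y
hadamard₁-cong f≗g y = cong₂ (λ u v → (entry H y false ⊗ u) ⊕ (entry H y true ⊗ v)) (f≗g false) (f≗g true)

quad₂-cong : ∀ {a a′ b b′ r r′ s s′ t t′} → a ≡ a′ → b ≡ b′ → r ≡ r′ → s ≡ s′ → t ≡ t′ →
  quad₂ a b r s t ≡ quad₂ a′ b′ r′ s′ t′
quad₂-cong refl refl refl refl refl = refl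

-- Pivoting

module _ {n} (q : ANF n) {i j : Fin n} (i≢j : i ≢ j) where

  private
    j≢i : j ≢ i
    j≢i j≡i = i≢j (sym j≡i)

    -- q = xᵢxⱼα + xᵢβ + xⱼγ + δ
    α β γ δ : ANF n
    α = cofactor j (cofactor i q)
    β = remainder j (cofactor i q)
    γ = cofactor j (remainder i q)
    δ = remainder j (remainder i q)

    lookup-[]≔²-other : ∀ {A : Set} (v : Vec A n) s t k → k ≢ i → k ≢ j → lookup (v [ j ]≔ t [ i ]≔ s) k ≡ lookup v k
    lookup-[]≔²-other v s t k k≢i k≢j = trans (VecP.lookup∘update′ k≢i (v [ j ]≔ t) s) (VecP.lookup∘update′ k≢j v t)

    lookup-[]≔²-j : ∀ {A : Set} (v : Vec A n) s t → lookup (v [ j ]≔ t [ i ]≔ s) j ≡ t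
    lookup-[]≔²-j v s t = trans (VecP.lookup∘update′ j≢i (v [ j ]≔ t) s) (VecP.lookup∘update j v t)

    zeros[]≔²≡pairMono : zeros [ j ]≔ true [ i ]≔ true ≡ pairMono i j
    zeros[]≔²≡pairMono = vec-ext pointwise
      where
      pointwise : ∀ k → lookup (zeros [ j ]≔ true [ i ]≔ true) k ≡ lookup (pairMono i j) k
      pointwise k with k FinP.≟ i | k FinP.≟ j
      ... | yes refl | _        = trans (VecP.lookup∘update k (zeros [ j ]≔ true) true) (sym (lookup-pairMono-i i j))
      ... | no _     | yes refl = trans (lookup-[]≔²-j zeros true true) (sym (lookup-pairMono-j i j))
      ... | no k≢i   | no k≢j   = trans (lookup-[]≔²-other zeros true true k k≢i k≢j)
                                  (trans (VecP.lookup-replicate k false) (sym (lookup-pairMono-other i j k k≢i k≢j)))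

    α-true : ∀ m → α m ≡ true →
      lookup m i ≡ false × lookup m j ≡ false × q (m [ j ]≔ true [ i ]≔ true) ≡ true
    α-true m αm with lookup m j | lookup (m [ j ]≔ true) i in m′ᵢ
    ... | false | false = trans (sym (VecP.lookup∘update′ i≢j m true)) m′ᵢ , refl , αm

    α-zeros : PivotOK q i j → α zeros ≡ true
    α-zeros (qᵢⱼ , _)
      rewrite VecP.lookup-replicate {n = n} j false
            | VecP.lookup∘update′ i≢j (zeros {n}) true
            | VecP.lookup-replicate {n = n} i false
            | zeros[]≔²≡pairMono = qᵢⱼ

    α≗point : PivotOK q i j → ∀ m → α m ≡ ⌊ zeros ≟ᵥ m ⌋
    α≗point ok m with α m in αm | zeros ≟ᵥ m
    ... | true  | yes _      = refl
    ... | false | no _       = refl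
    ... | false | yes refl   = trans (sym αm) (α-zeros ok)
    ... | true  | no zeros≢m with mᵢ , mⱼ , qm′ ← α-true m αm = ⊥-elim (zeros≢m (sym (vec-ext pointwise)))
      where
      m′≡pairMono : m [ j ]≔ true [ i ]≔ true ≡ pairMono i j
      m′≡pairMono = proj₂ ok _ qm′ (cong₂ _∧_ (VecP.lookup∘update i (m [ j ]≔ true) true) (lookup-[]≔²-j m true true))
      pointwise : ∀ k → lookup m k ≡ lookup zeros k
      pointwise k with k FinP.≟ i | k FinP.≟ j
      ... | yes refl | _        = trans mᵢ (sym (VecP.lookup-replicate k false))
      ... | no _     | yes refl = trans mⱼ (sym (VecP.lookup-replicate k false))
      ... | no k≢i   | no k≢j   = begin
        lookup m k                                  ≡⟨ sym (lookup-[]≔²-other m true true k k≢i k≢j) ⟩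
        lookup (m [ j ]≔ true [ i ]≔ true) k        ≡⟨ cong (λ u → lookup u k) m′≡pairMono ⟩
        lookup (pairMono i j) k                     ≡⟨ lookup-pairMono-other i j k k≢i k≢j ⟩
        false                                       ≡⟨ sym (VecP.lookup-replicate k false) ⟩
        lookup zeros k                              ∎
        where open ≡-Reasoning

    eval-α : PivotOK q i j → ∀ x → eval α x ≡ true
    eval-α ok x = trans (eval-cong (α≗point ok) x) (trans (sumOver-allVecs-point zeros (_⊆ᵇ x)) (zeros-⊆ᵇ x))

    not-∧-not : ∀ a b c → not b ∧ (not a ∧ c) ≡ not (a ∨ b) ∧ c
    not-∧-not true  b     c = ∧-zeroʳ (not b)
    not-∧-not false true  c = refl
    not-∧-not false false c = refl

    β≗Nᵢ : ∀ m → β m ≡ Nᵢ q i j m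
    β≗Nᵢ m = not-∧-not (lookup m i) (lookup m j) _

    γ≗Nⱼ : ∀ m → γ m ≡ Nⱼ q i j m
    γ≗Nⱼ m rewrite VecP.lookup∘update′ i≢j m true = not-∧-not (lookup m i) (lookup m j) _

    δ≗Rest : ∀ m → δ m ≡ Rest q i j m
    δ≗Rest m = not-∧-not (lookup m i) (lookup m j) _

    eval-avoiding : ∀ (c : ANF n) x s t →
      eval (λ m → avoids m i j ∧ c m) (x [ j ]≔ t [ i ]≔ s) ≡ eval (λ m → avoids m i j ∧ c m) x
    eval-avoiding c x s t =
      trans (eval-[]≔ r (λ m rm → proj₁ (avoids-∧-true m i j rm)) (x [ j ]≔ t) s)
            (eval-[]≔ r (λ m rm → proj₁ (proj₂ (avoids-∧-true m i j rm))) x t)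
      where
      r : ANF n
      r m = avoids m i j ∧ c m

  eval-quad₂ : PivotOK q i j → ∀ x →
    eval q x ≡ quad₂ (eval (Nᵢ q i j) x) (eval (Nⱼ q i j) x) (eval (Rest q i j) x) (lookup x i) (lookup x j)
  eval-quad₂ ok x = begin
    eval q x
      ≡⟨ eval-split i q x ⟩
    (lookup x i ∧ eval (cofactor i q) x) xor eval (remainder i q) x
      ≡⟨ cong₂ (λ u v → (lookup x i ∧ u) xor v) (eval-split j (cofactor i q) x) (eval-split j (remainder i q) x) ⟩
    (lookup x i ∧ ((lookup x j ∧ eval α x) xor eval β x)) xor ((lookup x j ∧ eval γ x) xor eval δ x)
      ≡⟨ cong₂ (λ u v → (lookup x i ∧ u) xor v)
               (cong₂ (λ u v → (lookup x j ∧ u) xor v) (eval-α ok x) (eval-cong β≗Nᵢ x))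
               (cong₂ (λ u v → (lookup x j ∧ u) xor v) (eval-cong γ≗Nⱼ x) (eval-cong δ≗Rest x)) ⟩
    (lookup x i ∧ ((lookup x j ∧ true) xor eval (Nᵢ q i j) x)) xor ((lookup x j ∧ eval (Nⱼ q i j) x) xor eval (Rest q i j) x)
      ≡⟨ expand (lookup x i) (lookup x j) _ _ ⟩
    quad₂ (eval (Nᵢ q i j) x) (eval (Nⱼ q i j) x) (eval (Rest q i j) x) (lookup x i) (lookup x j) ∎
    where
    open ≡-Reasoning
    expand : ∀ s t a rest → (s ∧ ((t ∧ true) xor a)) xor rest ≡ (s ∧ t) xor ((s ∧ a) xor rest)
    expand false t a rest = refl
    expand true  t a rest = trans (BoolP.xor-assoc (t ∧ true) a rest) (cong (_xor (a xor rest)) (∧-identityʳ t))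

  eval-pivot : ∀ x → eval (pivot q i j) x ≡
    quad₂ (eval (Nⱼ q i j) x) (eval (Nᵢ q i j) x) ((eval (Nᵢ q i j) x ∧ eval (Nⱼ q i j) x) xor eval (Rest q i j) x)
          (lookup x i) (lookup x j)
  eval-pivot x =
    trans (eval-+ᴬ (var i ·ᴬ var j) _ x)
    (cong₂ _xor_ (trans (eval-·ᴬ (var i) (var j) x) (cong₂ _∧_ (eval-var i x) (eval-var j x)))
    (trans (eval-+ᴬ (var i ·ᴬ Nⱼ q i j) _ x)
    (cong₂ _xor_ (trans (eval-·ᴬ (var i) (Nⱼ q i j) x) (cong (_∧ eval (Nⱼ q i j) x) (eval-var i x)))
    (trans (eval-+ᴬ (var j ·ᴬ Nᵢ q i j) _ x)
    (cong₂ _xor_ (trans (eval-·ᴬ (var j) (Nᵢ q i j) x) (cong (_∧ eval (Nᵢ q i j) x) (eval-var j x)))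
    (trans (eval-+ᴬ (Nᵢ q i j ·ᴬ Nⱼ q i j) _ x)
    (cong (_xor eval (Rest q i j) x) (eval-·ᴬ (Nᵢ q i j) (Nⱼ q i j) x))))))))

  hadamard²-pivot : PivotOK q i j → ∀ y →
    applyU (H-at j) (applyU (H-at i) (signVec q)) y ≡ signVec (pivot q i j) y
  hadamard²-pivot ok y = begin
    applyU (H-at j) (applyU (H-at i) (signVec q)) y
      ≡⟨ applyU-H-at j _ y ⟩
    hadamard₁ (λ t → applyU (H-at i) (signVec q) (y [ j ]≔ t)) (lookup y j)
      ≡⟨ hadamard₁-cong (λ t → trans (applyU-H-at i (signVec q) (y [ j ]≔ t))
                                     (trans (hadamard₁-cong (λ s → cong sgn (eval-at s t)) (lookup (y [ j ]≔ t) i))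
                                            (cong (hadamard₁ (λ s → sgn (quad₂ a b r s t))) (VecP.lookup∘update′ i≢j y t)))) (lookup y j) ⟩
    hadamard₁ (λ t → hadamard₁ (λ s → sgn (quad₂ a b r s t)) (lookup y i)) (lookup y j)
      ≡⟨ hadamard²-quad₂ a b r (lookup y i) (lookup y j) ⟩
    sgn (quad₂ b a ((a ∧ b) xor r) (lookup y i) (lookup y j))
      ≡⟨ cong sgn (sym (eval-pivot y)) ⟩
    signVec (pivot q i j) y ∎
    where
    open ≡-Reasoning
    a b r : Bool
    a = eval (Nᵢ q i j) y
    b = eval (Nⱼ q i j) y
    r = eval (Rest q i j) y
    eval-at : ∀ s t → eval q (y [ j ]≔ t [ i ]≔ s) ≡ quad₂ a b r s t
    eval-at s t = trans (eval-quad₂ ok _)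
      (quad₂-cong (eval-avoiding _ y s t) (eval-avoiding _ y s t) (eval-avoiding _ y s t)
                  (VecP.lookup∘update i (y [ j ]≔ t) s) (lookup-[]≔²-j y s t))

-- Hadamard factors without Hadamard neighbours

isolated-hadamard-vanishes : ∀ {n} (q : ANF n) (U : Vec Gate n) (i : Fin n) → DegreeAtMost2 q → lookup U i ≡ H →
  (∀ j → lookup U j ≡ H → j ≢ i → q (pairMono i j) ≢ true) → ∃ λ y → applyU U (signVec q) y ≡ zeroQ2
isolated-hadamard-vanishes {n} q U i deg-q Uᵢ≡H isolated =
  y , trans (applyU-factor U i Uᵢ≡H (signVec q) y) (applyU-vanishes U′ _ y Hᵢ-vanishes)
  where
  U′ : Vec Gate n
  U′ = U [ i ]≔ I
  A B : ANF n
  A = cofactor i q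
  B = remainder i q
  y : Vec Bool n
  y = zeros [ i ]≔ not (eval A zeros)

  A-vars-under-I : ∀ m → A m ≡ true → ∀ k → lookup m k ≡ true → lookup U′ k ≡ I
  A-vars-under-I m Am k mₖ with lookup U k in Uₖ
  ... | I = trans (VecP.lookup∘update′ k≢i U I) Uₖ
    where
    k≢i : k ≢ i
    k≢i refl with () ← trans (sym mₖ) (cofactor-avoids i q m Am)
  ... | H = ⊥-elim (isolated k Uₖ k≢i (subst (λ u → q u ≡ true) m′≡pairMono qm′))
    where
    k≢i : k ≢ i
    k≢i refl with () ← trans (sym mₖ) (cofactor-avoids i q m Am)
    qm′ : q (m [ i ]≔ true) ≡ true
    qm′ = proj₂ (not-∧-true (lookup m i) Am)
    m′≡pairMono : m [ i ]≔ true ≡ pairMono i k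
    m′≡pairMono = weight≤2⇒pairMono _ (deg-q _ qm′) (λ i≡k → k≢i (sym i≡k))
                    (VecP.lookup∘update i m true) (trans (VecP.lookup∘update′ k≢i m true) mₖ)

  Hᵢ-vanishes : ∀ x → (∀ k → lookup U′ k ≡ I → lookup x k ≡ lookup y k) → applyU (H-at i) (signVec q) x ≡ zeroQ2
  Hᵢ-vanishes x x≈y = begin
    applyU (H-at i) (signVec q) x
      ≡⟨ applyU-H-at i (signVec q) x ⟩
    hadamard₁ (λ s → sgn (eval q (x [ i ]≔ s))) (lookup x i)
      ≡⟨ hadamard₁-cong (λ s → cong sgn (split s)) (lookup x i) ⟩
    hadamard₁ (λ s → sgn ((s ∧ eval A x) xor eval B x)) (lookup x i)
      ≡⟨ hadamard-affine-vanishes (eval A x) (eval B x) (lookup x i) xᵢ+Ax≡1 ⟩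
    zeroQ2 ∎
    where
    open ≡-Reasoning
    split : ∀ s → eval q (x [ i ]≔ s) ≡ (s ∧ eval A x) xor eval B x
    split s = trans (eval-split i q (x [ i ]≔ s))
      (cong₂ _xor_ (cong₂ _∧_ (VecP.lookup∘update i x s) (eval-[]≔ A (cofactor-avoids i q) x s))
                   (eval-[]≔ B (remainder-avoids i q) x s))
    xᵢ≡ : lookup x i ≡ not (eval A zeros)
    xᵢ≡ = trans (x≈y i (VecP.lookup∘update i U I)) (VecP.lookup∘update i zeros _)
    Ax≡ : eval A x ≡ eval A zeros
    Ax≡ = trans (eval-agree A (λ k → lookup U′ k ≡ I) A-vars-under-I x y x≈y)
                (eval-[]≔ A (cofactor-avoids i q) zeros _)
    xᵢ+Ax≡1 : lookup x i xor eval A x ≡ true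
    xᵢ+Ax≡1 rewrite xᵢ≡ | Ax≡ = BoolP.xor-inverseˡ (eval A zeros)

_≟ᴳ_ : (g h : Gate) → Dec (g ≡ h)
I ≟ᴳ I = yes refl
I ≟ᴳ H = no λ ()
H ≟ᴳ I = no λ ()
H ≟ᴳ H = yes refl

hadamardCount : ∀ {n} → Vec Gate n → ℕ
hadamardCount []      = 0
hadamardCount (I ∷ U) = hadamardCount U
hadamardCount (H ∷ U) = suc (hadamardCount U)

hadamardCount-[]≔I : ∀ {n} (U : Vec Gate n) i → lookup U i ≡ H → hadamardCount U ≡ suc (hadamardCount (U [ i ]≔ I))
hadamardCount-[]≔I (H ∷ U) zero    refl  = refl
hadamardCount-[]≔I (I ∷ U) (suc i) Uᵢ≡H = hadamardCount-[]≔I U i Uᵢ≡H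
hadamardCount-[]≔I (H ∷ U) (suc i) Uᵢ≡H = cong suc (hadamardCount-[]≔I U i Uᵢ≡H)

hadamard-position : ∀ {n} (U : Vec Gate n) → U ≢ replicate n I → ∃ λ i → lookup U i ≡ H
hadamard-position {n} U U≢I with FinP.any? (λ i → lookup U i ≟ᴳ H)
... | yes found = found
... | no  none  = ⊥-elim (U≢I (vec-ext all-I))
  where
  all-I : ∀ k → lookup U k ≡ lookup (replicate n I) k
  all-I k with lookup U k in Uₖ
  ... | I = sym (VecP.lookup-replicate k I)
  ... | H = ⊥-elim (none (k , Uₖ))

edge⇒PivotOK : ∀ {n} {q : ANF n} {i j} → DegreeAtMost2 q → i ≢ j → q (pairMono i j) ≡ true → PivotOK q i j
edge⇒PivotOK deg-q i≢j qᵢⱼ =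
  qᵢⱼ , λ m qm mᵢ∧mⱼ → weight≤2⇒pairMono m (deg-q m qm) i≢j (proj₁ (∧-true mᵢ∧mⱼ)) (proj₂ (∧-true mᵢ∧mⱼ))
  where
  ∧-true : ∀ {a b} → a ∧ b ≡ true → a ≡ true × b ≡ true
  ∧-true {true} b≡true = refl , b≡true

applyU-pivot : ∀ {n} (U : Vec Gate n) (q : ANF n) {i j} → i ≢ j → lookup U i ≡ H → lookup U j ≡ H → PivotOK q i j →
  ∀ y → applyU U (signVec q) y ≡ applyU (U [ i ]≔ I [ j ]≔ I) (signVec (pivot q i j)) y
applyU-pivot U q {i} {j} i≢j Uᵢ≡H Uⱼ≡H ok y =
  trans (applyU-factor U i Uᵢ≡H (signVec q) y)
  (trans (applyU-factor (U [ i ]≔ I) j (trans (VecP.lookup∘update′ (λ j≡i → i≢j (sym j≡i)) U I) Uⱼ≡H) _ y)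
         (applyU-cong (U [ i ]≔ I [ j ]≔ I) (hadamard²-pivot q i≢j ok) y))

PivotsTo : ∀ {n} → ANF n → Vec Gate n → Set
PivotsTo {n} q U = Σ (ANF n) λ p′ → PivotSeq q p′ × (∀ x → applyU U (signVec q) x ≡ signVec p′ x)

flat⇒pivots : ∀ {n} (U : Vec Gate n) → Acc _<_ (hadamardCount U) →
  (q : ANF n) → DegreeAtMost2 q → Flat (applyU U (signVec q)) → PivotsTo q U
flat⇒pivots {n} U (acc smaller) q deg-q flat with VecP.≡-dec _≟ᴳ_ U (replicate n I)
... | yes refl = q , ε , applyU-identity n (signVec q)
... | no U≢I
  with i , Uᵢ≡H ← hadamard-position U U≢I
  with FinP.any? (λ j → (lookup U j ≟ᴳ H) ×-dec (¬? (j FinP.≟ i) ×-dec (q (pairMono i j) BoolP.≟ true)))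
... | no isolated
  with y , Uq[y]≡0 ← isolated-hadamard-vanishes q U i deg-q Uᵢ≡H (λ j Uⱼ j≢i qᵢⱼ → isolated (j , Uⱼ , j≢i , qᵢⱼ))
  = ⊥-elim (zeroQ2-not-unit (subst (λ z → z ⊗ z ≡ oneQ2) Uq[y]≡0 (flat y)))
... | yes (j , Uⱼ≡H , j≢i , qᵢⱼ) =
  let p′ , pivots , U″q′≡p′ = flat⇒pivots U″ (smaller fewer) q′ (Degree≤-pivot {q = q} deg-q) flat′
  in  p′ , (i , j , i≢j , ok , refl) ◅ pivots , λ x → trans (Uq≡U″q′ x) (U″q′≡p′ x)
  where
  i≢j : i ≢ j
  i≢j i≡j = j≢i (sym i≡j)
  ok : PivotOK q i j
  ok = edge⇒PivotOK deg-q i≢j qᵢⱼ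
  U″ : Vec Gate n
  U″ = U [ i ]≔ I [ j ]≔ I
  q′ : ANF n
  q′ = pivot q i j
  Uq≡U″q′ : ∀ y → applyU U (signVec q) y ≡ applyU U″ (signVec q′) y
  Uq≡U″q′ = applyU-pivot U q i≢j Uᵢ≡H Uⱼ≡H ok
  flat′ : Flat (applyU U″ (signVec q′))
  flat′ y = subst (λ z → z ⊗ z ≡ oneQ2) (Uq≡U″q′ y) (flat y)
  fewer : hadamardCount U″ < hadamardCount U
  fewer = NP.≤-trans (NP.n≤1+n _)
    (NP.≤-reflexive (sym (trans (hadamardCount-[]≔I U i Uᵢ≡H)
      (cong suc (hadamardCount-[]≔I (U [ i ]≔ I) j (trans (VecP.lookup∘update′ j≢i U I) Uⱼ≡H))))))

theorem6 : (n : ℕ) (p : ANF n) → DegreeAtMost2 p →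
    (U : Vec Gate n) → U ≢ replicate n I →
    Flat (applyU U (signVec p)) →
    Σ (ANF n) λ p′ → PivotSeq p p′ × (∀ x → applyU U (signVec p) x ≡ signVec p′ x)
theorem6 n p deg-p U _ flat = flat⇒pivots U (<-wellFounded (hadamardCount U)) p deg-p flat
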